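{- Let $G$ be an arbitrary finite directed graph. The set $\{x\in\{+,-\}^*\mid p(x)\to G\}$ is a regular language over the alphabet $\{+,-\}$.
   Context: A homomorphism $H\to G$ is a map $V(H)\to V(G)$ sending edges to edges; $H\to G$ means one exists. For a word $x=x_1\ldots x_k\in\{+,-\}^k$ ($k\ge 0$), $p(x)$ denotes the oriented path with vertices $w_0,\dots,w_k$, the $i$-th edge being $(w_{i-1},w_i)$ if $x_i=+$ and $(w_i,w_{i-1})$ if $x_i=-$. -}

module Defs where

open import Data.Nat using (ℕ; suc)
open import Data.Fin using (Fin; inject₁) renaming (suc to fsuc)
open import Data.Bool using (Bool; true; T)
open import Data.List using (List; []; _∷_; length; lookup)
open import Data.Product using (Σ; _×_; ∃)
open import Data.Sum using (_⊎_)
open import Relation.Binary.PropositionalEquality using (_≡_)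
open import Function.Bundles using (_⇔_)

data Sign : Set where
  plus minus : Sign

Word : Set
Word = List Sign

record Digraph : Set₁ where
  field
    size : ℕ
    Edge : Fin size → Fin size → Set
open Digraph public

fromAdj : (n : ℕ) → (Fin n → Fin n → Bool) → Digraph
fromAdj n adj = record { size = n ; Edge = λ u v → T (adj u v) }

-- The oriented path p(x): vertices w_0..w_k (as Fin (suc k)), the i-th edge
-- (0-indexed here) is (w_i, w_{i+1}) if x_i = + and (w_{i+1}, w_i) if x_i = -.
pathEdge : (x : Word) → Fin (suc (length x)) → Fin (suc (length x)) → Set
pathEdge x u v = ∃ λ (i : Fin (length x)) →
    (lookup x i ≡ plus  × u ≡ inject₁ i × v ≡ fsuc i)
  ⊎ (lookup x i ≡ minus × u ≡ fsuc i × v ≡ inject₁ i)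

p : Word → Digraph
p x = record { size = suc (length x) ; Edge = pathEdge x }

_⟶_ : Digraph → Digraph → Set
H ⟶ G = Σ (Fin (size H) → Fin (size G)) λ f →
          ∀ u v → Edge H u v → Edge G (f u) (f v)

record DFA : Set where
  field
    states : ℕ
    start  : Fin states
    δ      : Fin states → Sign → Fin states
    accept : Fin states → Bool

run : (A : DFA) → Fin (DFA.states A) → Word → Fin (DFA.states A)
run A q []      = q
run A q (s ∷ w) = run A (DFA.δ A q s) w

accepts : DFA → Word → Bool
accepts A w = DFA.accept A (run A (DFA.start A) w)

Regular : (Word → Set) → Set
Regular L = Σ DFA λ A → ∀ w → L w ⇔ (accepts A w ≡ true)

-- A homomorphism p(x) → G is the same thing as a walk in G that traverses its
-- i-th edge forwards or backwards according to x_i. Reading G as a nondeterministic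
-- automaton over {+,-} in which every vertex is initial and accepting, these walks
-- are exactly its runs; the subset construction turns it into a DFA whose states
-- are the 2^|V(G)| sets of vertices.
module Submission where

open import Defs
open import Level using (0ℓ)
open import Data.Nat using (ℕ; suc; _^_)
open import Data.Fin using (Fin; zero; fromℕ; funToFin; finToFun) renaming (suc to fsuc)
open import Data.Fin.Properties using (2↔Bool; finToFun-funToFin; any?)
open import Data.Bool using (Bool; true; T)
open import Data.Bool.Properties using (T-≡)
open import Data.List using ([]; _∷_; length)
open import Data.Product using (_×_; _,_; ∃; ∃₂)
open import Data.Sum using (inj₁; inj₂)
open import Data.Unit using (⊤; tt)
open import Relation.Nullary using (Dec; yes)
open import Relation.Nullary.Decidable using (T?; _×-dec_; ⌊_⌋; toWitness; fromWitness)
open import Relation.Unary using (Pred; Decidable)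
open import Relation.Binary.PropositionalEquality using (_≡_; refl; sym; cong; trans; subst)
open import Function using (_∘_)
open import Function.Bundles using (_⇔_; mk⇔; Inverse)
open Function.Bundles.Equivalence using (to; from)
open import Function.Properties.Equivalence using () renaming (trans to ⇔-trans)
open import Function.Construct.Symmetry using (⇔-sym)

Regular-resp-⇔ : ∀ {L L′ : Word → Set} → (∀ w → L w ⇔ L′ w) → Regular L → Regular L′
Regular-resp-⇔ L⇔L′ (A , L⇔A) = A , λ w → ⇔-trans (⇔-sym (L⇔L′ w)) (L⇔A w)

data Path {A : Set} (R : A → Sign → A → Set) : A → Word → A → Set where
  []  : ∀ {q} → Path R q [] q
  _∷_ : ∀ {q s r w t} → R q s r → Path R r w t → Path R q (s ∷ w) t

record NFA : Set₁ where
  field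
    states   : ℕ
    Initial  : Pred (Fin states) 0ℓ
    Final    : Pred (Fin states) 0ℓ
    Step     : Fin states → Sign → Fin states → Set
    initial? : Decidable Initial
    final?   : Decidable Final
    step?    : ∀ q s r → Dec (Step q s r)

  Accepts : Word → Set
  Accepts w = ∃₂ λ q r → Initial q × Path Step q w r × Final r

module SubsetConstruction (N : NFA) where
  open NFA N

  StateSet : Set
  StateSet = Fin states → Bool

  _∈_ : Fin states → StateSet → Set
  q ∈ S = T (S q)

  ⟦_⟧ : ∀ {P : Pred (Fin states) 0ℓ} → Decidable P → StateSet
  ⟦ P? ⟧ q = ⌊ P? q ⌋

  ∈⟦⟧⇔ : ∀ {P : Pred (Fin states) 0ℓ} (P? : Decidable P) q → q ∈ ⟦ P? ⟧ ⇔ P q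
  ∈⟦⟧⇔ P? q = mk⇔ toWitness fromWitness

  Post : StateSet → Sign → Pred (Fin states) 0ℓ
  Post S s r = ∃ λ q → q ∈ S × Step q s r

  post? : ∀ S s → Decidable (Post S s)
  post? S s r = any? λ q → T? (S q) ×-dec step? q s r

  encode : StateSet → Fin (2 ^ states)
  encode S = funToFin (Inverse.from 2↔Bool ∘ S)

  decode : Fin (2 ^ states) → StateSet
  decode i = Inverse.to 2↔Bool ∘ finToFun i

  decode-encode : ∀ S q → decode (encode S) q ≡ S q
  decode-encode S q = trans (cong (Inverse.to 2↔Bool) (finToFun-funToFin _ q))
                            (Inverse.strictlyInverseˡ 2↔Bool (S q))

  ∈-decode-encode⇔ : ∀ S q → q ∈ decode (encode S) ⇔ q ∈ S
  ∈-decode-encode⇔ S q = mk⇔ (subst T (decode-encode S q)) (subst T (sym (decode-encode S q)))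

  determinise : DFA
  determinise = record
    { states = 2 ^ states
    ; start  = encode ⟦ initial? ⟧
    ; δ      = λ i s → encode ⟦ post? (decode i) s ⟧
    ; accept = λ i → ⌊ any? (λ r → T? (decode i r) ×-dec final? r) ⌋
    }

  open DFA determinise using (start; δ; accept)

  ∈-start⇔ : ∀ q → q ∈ decode start ⇔ Initial q
  ∈-start⇔ q = ⇔-trans (∈-decode-encode⇔ ⟦ initial? ⟧ q) (∈⟦⟧⇔ initial? q)

  ∈-δ⇔ : ∀ i s r → r ∈ decode (δ i s) ⇔ Post (decode i) s r
  ∈-δ⇔ i s r = ⇔-trans (∈-decode-encode⇔ ⟦ post? (decode i) s ⟧ r) (∈⟦⟧⇔ (post? (decode i) s) r)

  accept⇔ : ∀ i → T (accept i) ⇔ ∃ λ r → r ∈ decode i × Final r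
  accept⇔ i = mk⇔ toWitness fromWitness

  ∈-run⇔ : ∀ i w r → r ∈ decode (run determinise i w) ⇔ ∃ λ q → q ∈ decode i × Path Step q w r
  ∈-run⇔ i []      r = mk⇔ (λ r∈ → r , r∈ , []) λ { (q , q∈ , []) → q∈ }
  ∈-run⇔ i (s ∷ w) r = mk⇔ ⇒ ⇐
    where
    IH = ∈-run⇔ (δ i s) w r

    ⇒ : r ∈ decode (run determinise (δ i s) w) → ∃ λ q → q ∈ decode i × Path Step q (s ∷ w) r
    ⇒ r∈ with to IH r∈
    ... | q′ , q′∈ , π with to (∈-δ⇔ i s q′) q′∈
    ... | q , q∈ , e = q , q∈ , e ∷ π

    ⇐ : (∃ λ q → q ∈ decode i × Path Step q (s ∷ w) r) → r ∈ decode (run determinise (δ i s) w)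
    ⇐ (q , q∈ , e ∷ π) = from IH (_ , from (∈-δ⇔ i s _) (q , q∈ , e) , π)

  determinise-correct : ∀ w → Accepts w ⇔ (accepts determinise w ≡ true)
  determinise-correct w =
    ⇔-trans (mk⇔ ⇒ ⇐) (⇔-trans (⇔-sym (accept⇔ (run determinise start w))) T-≡)
    where
    ⇒ : Accepts w → ∃ λ r → r ∈ decode (run determinise start w) × Final r
    ⇒ (q , r , qI , π , rF) = r , from (∈-run⇔ start w r) (q , from (∈-start⇔ q) qI , π) , rF

    ⇐ : (∃ λ r → r ∈ decode (run determinise start w) × Final r) → Accepts w
    ⇐ (r , r∈ , rF) with to (∈-run⇔ start w r) r∈
    ... | q , q∈ , π = q , r , to (∈-start⇔ q) q∈ , π , rF

NFA-regular : (N : NFA) → Regular (NFA.Accepts N)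
NFA-regular N = determinise , determinise-correct
  where open SubsetConstruction N

pathVertex : ∀ {A R u w v} → Path {A} R u w v → Fin (suc (length w)) → A
pathVertex {u = u} _       zero     = u
pathVertex         (_ ∷ π) (fsuc i) = pathVertex π i

SignedEdge : (G : Digraph) → Fin (size G) → Sign → Fin (size G) → Set
SignedEdge G u plus  v = Edge G u v
SignedEdge G u minus v = Edge G v u

pathEdge-suc : ∀ {s w a b} → pathEdge w a b → pathEdge (s ∷ w) (fsuc a) (fsuc b)
pathEdge-suc (i , inj₁ (x , refl , refl)) = fsuc i , inj₁ (x , refl , refl)
pathEdge-suc (i , inj₂ (x , refl , refl)) = fsuc i , inj₂ (x , refl , refl)

module _ (G : Digraph) where

  pathVertex-hom : ∀ {u w v} (π : Path (SignedEdge G) u w v) a b →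
                   pathEdge w a b → Edge G (pathVertex π a) (pathVertex π b)
  pathVertex-hom (e ∷ π) _ _ (zero , inj₁ (refl , refl , refl)) = e
  pathVertex-hom (e ∷ π) _ _ (zero , inj₂ (refl , refl , refl)) = e
  pathVertex-hom (e ∷ π) _ _ (fsuc i , inj₁ (x , refl , refl)) =
    pathVertex-hom π _ _ (i , inj₁ (x , refl , refl))
  pathVertex-hom (e ∷ π) _ _ (fsuc i , inj₂ (x , refl , refl)) =
    pathVertex-hom π _ _ (i , inj₂ (x , refl , refl))

  hom-path : ∀ w (f : Fin (suc (length w)) → Fin (size G)) →
             (∀ a b → pathEdge w a b → Edge G (f a) (f b)) →
             Path (SignedEdge G) (f zero) w (f (fromℕ (length w)))
  hom-path []          f hom = []
  hom-path (plus ∷ w)  f hom = hom zero (fsuc zero) (zero , inj₁ (refl , refl , refl))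
                             ∷ hom-path w (f ∘ fsuc) λ a b → hom (fsuc a) (fsuc b) ∘ pathEdge-suc
  hom-path (minus ∷ w) f hom = hom (fsuc zero) zero (zero , inj₂ (refl , refl , refl))
                             ∷ hom-path w (f ∘ fsuc) λ a b → hom (fsuc a) (fsuc b) ∘ pathEdge-suc

  hom⇔path : ∀ w → p w ⟶ G ⇔ ∃₂ λ u v → Path (SignedEdge G) u w v
  hom⇔path w = mk⇔ (λ (f , hom) → _ , _ , hom-path w f hom)
                   (λ (_ , _ , π) → pathVertex π , pathVertex-hom π)

signNFA : (n : ℕ) → (Fin n → Fin n → Bool) → NFA
signNFA n adj = record
  { states   = n
  ; Initial  = λ _ → ⊤
  ; Final    = λ _ → ⊤
  ; Step     = SignedEdge (fromAdj n adj)
  ; initial? = λ _ → yes tt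
  ; final?   = λ _ → yes tt
  ; step?    = λ { u plus v → T? (adj u v) ; u minus v → T? (adj v u) }
  }

signNFA-accepts⇔hom : ∀ n adj w → NFA.Accepts (signNFA n adj) w ⇔ p w ⟶ fromAdj n adj
signNFA-accepts⇔hom n adj w = ⇔-trans
  (mk⇔ (λ (u , v , _ , π , _) → u , v , π) (λ (u , v , π) → u , v , tt , π , tt))
  (⇔-sym (hom⇔path (fromAdj n adj) w))

lemma11 : (n : ℕ) (adj : Fin n → Fin n → Bool) →
    Regular (λ x → p x ⟶ fromAdj n adj)
lemma11 n adj = Regular-resp-⇔ (signNFA-accepts⇔hom n adj) (NFA-regular (signNFA n adj))
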